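{- Let $n\ge1$, let $x_1,\dots,x_n$ be distinct integers greater than $1$, and let $D=\{1,0,x_1,\dots,x_n\}$. If $(T,s)$ is an optimal signed tree realizing $D$ and $uv$ is the unique edge of $T$ with $s(uv)=-$, then $\deg(u)=\deg(v)=2$.
   Context: A signed tree is a pair $(T,s)$ with $T$ a finite tree and $s:E(T)\to\{+,-\}$. The signed degree $sdeg(v)$ of a vertex is the number of incident positive edges minus the number of incident negative edges. $(T,s)$ realizes $D$ if $D=\{sdeg(v):v\in V(T)\}$. $\sigma(D)$ is the minimum number of vertices of a tree $T$ such that some signed tree $(T,s)$ realizes $D$; a signed tree $(T,s)$ realizing $D$ is optimal if $|V(T)|=\sigma(D)$. (For such $D$, an optimal signed tree has exactly one negative edge.) -}

module Defs where

open import Data.Bool using (Bool; true; false)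
open import Data.Nat using (ℕ; suc; _∸_; _<ᵇ_)
open import Data.Integer using (ℤ; +_; _-_)
open import Data.Fin using (Fin; toℕ)
open import Data.List using (List; allFin; filterᵇ; length; concatMap; map)
open import Data.List.Membership.Propositional using (_∈_)
open import Data.Maybe using (Maybe; just; nothing)
open import Data.Product using (_×_; Σ; ∃)
open import Relation.Binary.PropositionalEquality using (_≡_)
open import Relation.Nullary using (¬_)

data Sign : Set where
  pos neg : Sign

-- A signed graph on vertex set Fin m, given by a "signed adjacency" function:
-- G i j = nothing means i and j are not adjacent, G i j = just s means that
-- ij is an edge with sign s.
SignedGraph : ℕ → Set
SignedGraph m = Fin m → Fin m → Maybe Sign

isEdgeᵇ : Maybe Sign → Bool
isEdgeᵇ nothing  = false
isEdgeᵇ (just _) = true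

isPosᵇ : Maybe Sign → Bool
isPosᵇ (just pos) = true
isPosᵇ _          = false

isNegᵇ : Maybe Sign → Bool
isNegᵇ (just neg) = true
isNegᵇ _          = false

IsSimple : ∀ {m} → SignedGraph m → Set
IsSimple {m} G = (∀ i j → G i j ≡ G j i) × (∀ i → G i i ≡ nothing)

deg : ∀ {m} → SignedGraph m → Fin m → ℕ
deg {m} G v = length (filterᵇ (λ w → isEdgeᵇ (G v w)) (allFin m))

sdeg : ∀ {m} → SignedGraph m → Fin m → ℤ
sdeg {m} G v = + length (filterᵇ (λ w → isPosᵇ (G v w)) (allFin m))
             - + length (filterᵇ (λ w → isNegᵇ (G v w)) (allFin m))

edgeCount : ∀ {m} → SignedGraph m → ℕ
edgeCount {m} G =
  length (concatMap (λ i → filterᵇ (λ j → (toℕ i <ᵇ toℕ j) Data.Bool.∧ isEdgeᵇ (G i j)) (allFin m))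
                    (allFin m))
  where import Data.Bool

data Reach {m} (G : SignedGraph m) : Fin m → Fin m → Set where
  here  : ∀ {u} → Reach G u u
  there : ∀ {u w v} {s : Sign} → G u w ≡ just s → Reach G w v → Reach G u v

Connected : ∀ {m} → SignedGraph m → Set
Connected {m} G = ∀ (u v : Fin m) → Reach G u v

IsSignedTree : ∀ {m} → SignedGraph m → Set
IsSignedTree {m} G = (1 Data.Nat.≤ m) × IsSimple G × Connected G × edgeCount G ≡ m ∸ 1
  where import Data.Nat

-- (T,s) realizes D (D given as a list of integers, read as a set):
-- D = { sdeg v : v ∈ V(T) }.
Realizes : ∀ {m} → SignedGraph m → List ℤ → Set
Realizes {m} G D = (∀ (v : Fin m) → sdeg G v ∈ D)
                 × (∀ d → d ∈ D → ∃ λ (v : Fin m) → sdeg G v ≡ d)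

OptimalRealization : ∀ {m} → SignedGraph m → List ℤ → Set
OptimalRealization {m} G D =
  IsSignedTree G × Realizes G D ×
  (∀ (m' : ℕ) (H : SignedGraph m') → IsSignedTree H → Realizes H D → m Data.Nat.≤ m')
  where import Data.Nat

{-# OPTIONS --safe #-}
-- Starting from the path + − + on four vertices (signed degrees
-- 1, 0, 0, 1) and repeatedly attaching xᵢ − 1 positive leaves to a vertex of signed degree 1
-- realizes D on 4 + Σ (xᵢ − 1) vertices, so an optimal tree has at most that many.
-- Conversely, in a tree on m vertices the excesses deg w − 1 add up to m − 2. Away from the
-- endpoints u, v of the negative edge sdeg = deg ≥ 1, so 0 is realized at u, say, and deg u = 2.
-- If deg v ≠ 2 then sdeg v ∈ {1, x₁, …, xₙ}; distinct vertices realizing 1, x₁, …, xₙ, chosen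
-- to include v, have excesses adding up to at least Σ (xᵢ − 1) + 2, since v has two more edges
-- than its signed degree, and u adds 1 more: then m ≥ Σ (xᵢ − 1) + 5, contradicting optimality.
module Submission where

open import Data.Bool using (Bool; true; false; _∧_; if_then_else_)
open import Data.Empty using (⊥-elim)
open import Data.Fin using (Fin; zero; suc; toℕ; _≟_; _↑ʳ_)
open import Data.Fin.Properties using (toℕ-injective; ↑ʳ-injective)
open import Data.Integer as ℤ using (ℤ; +_; _-_; _<_; ∣_∣; +<+)
import Data.Integer.Properties as ℤ
open import Data.List using (List; []; _∷_; _++_; map; length; filterᵇ; tabulate; concatMap; allFin)
open import Data.List.Properties using (length-++; map-∘; map-cong-local)
open import Data.List.Membership.Propositional using (_∈_)
open import Data.List.Relation.Unary.All as All using (All; []; _∷_)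
open import Data.List.Relation.Unary.AllPairs using ([]; _∷_)
open import Data.List.Relation.Unary.Any using (here; there)
open import Data.List.Relation.Unary.Unique.Propositional using (Unique)
open import Data.List.Relation.Unary.Unique.Propositional.Properties using (map⁻)
open import Data.Maybe using (Maybe; just; nothing)
open import Data.Nat.ListAction using (sum)
open import Data.Nat as ℕ using (ℕ; zero; suc; _+_; _*_; _∸_; _≤_; z≤n; s≤s)
open import Data.Nat.Properties
  using ( _<?_; <-cmp; <⇒≯; <⇒≢; <⇒≱; n≮n; ≤-trans; ≤-reflexive; m≤m+n; m∸n+n≡m; ∸-monoˡ-≤
        ; +-assoc; +-comm; +-suc; +-identityʳ; +-cancelʳ-≡; +-mono-≤; +-monoˡ-≤; +-monoʳ-≤
        ; +-0-commutativeMonoid; +-commutativeSemigroup; module ≤-Reasoning )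
open import Data.Product using (_×_; _,_; proj₁; proj₂; ∃; swap)
open import Data.Sum as Sum using (_⊎_; inj₁; inj₂)
open import Data.Vec.Functional using (updateAt)
open import Data.Vec.Functional.Properties using (updateAt-updates; updateAt-minimal)
open import Function using (_∘_; const)
open import Relation.Binary.PropositionalEquality
open import Relation.Binary.Definitions using (DecidableEquality; tri<; tri≈; tri>)
open import Relation.Nullary using (¬_; Dec; yes; no; does)
open import Relation.Nullary.Decidable using (dec-true; dec-false)

open import Defs

open import Algebra.Properties.CommutativeMonoid.Sum +-0-commutativeMonoid
  using (∑-distrib-+; ∑-comm; sum-cong-≗; sum-replicate-zero) renaming (sum to ∑)
open import Algebra.Properties.CommutativeSemigroup +-commutativeSemigroup using (x∙yz≈y∙xz)
open import Algebra.Properties.AbelianGroup ℤ.+-0-abelianGroup using (//-rightDividesˡ)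

indicator : Bool → ℕ
indicator true  = 1
indicator false = 0

count : ∀ {m} → (Fin m → Bool) → ℕ
count p = ∑ (indicator ∘ p)

∑-pullOut : ∀ {m} (f : Fin m → ℕ) i → ∑ f ≡ f i + ∑ (updateAt f i (const 0))
∑-pullOut f zero    = refl
∑-pullOut f (suc i) = begin
  f zero + ∑ (f ∘ suc)                                        ≡⟨ cong (_+_ (f zero)) (∑-pullOut (f ∘ suc) i) ⟩
  f zero + (f (suc i) + ∑ (updateAt (f ∘ suc) i (const 0)))   ≡⟨ x∙yz≈y∙xz (f zero) (f (suc i)) _ ⟩
  f (suc i) + (f zero + ∑ (updateAt (f ∘ suc) i (const 0)))   ∎
  where open ≡-Reasoning

term≤∑ : ∀ {m} (f : Fin m → ℕ) i → f i ≤ ∑ f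
term≤∑ f i = subst (f i ≤_) (sym (∑-pullOut f i)) (m≤m+n (f i) _)

∑-zero : ∀ {m} {f : Fin m → ℕ} → (∀ i → f i ≡ 0) → ∑ f ≡ 0
∑-zero {m} f≡0 = trans (sum-cong-≗ f≡0) (sum-replicate-zero m)

∑-single : ∀ {m} (f : Fin m → ℕ) i → (∀ j → j ≢ i → f j ≡ 0) → ∑ f ≡ f i
∑-single f i rest≡0 = begin
  ∑ f                               ≡⟨ ∑-pullOut f i ⟩
  f i + ∑ (updateAt f i (const 0))  ≡⟨ cong (_+_ (f i)) (∑-zero updated≡0) ⟩
  f i + 0                           ≡⟨ +-identityʳ (f i) ⟩
  f i                               ∎
  where
  open ≡-Reasoning
  updated≡0 : ∀ j → updateAt f i (const 0) j ≡ 0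
  updated≡0 j with j ≟ i
  ... | yes refl = updateAt-updates i f
  ... | no j≢i   = trans (updateAt-minimal j i f j≢i) (rest≡0 j j≢i)

∑-one : ∀ m → ∑ {m} (const 1) ≡ m
∑-one zero    = refl
∑-one (suc m) = cong suc (∑-one m)

sum-map-≤-∑ : ∀ {m} (f : Fin m → ℕ) {L} → Unique L → sum (map f L) ≤ ∑ f
sum-map-≤-∑ f {[]}    []            = z≤n
sum-map-≤-∑ {m} f {i ∷ L} (i∉L ∷ uniq) = begin
  f i + sum (map f L)   ≡⟨ cong (λ ys → f i + sum ys) (map-cong-local (All.map f≡f₀ i∉L)) ⟩
  f i + sum (map f₀ L)  ≤⟨ +-monoʳ-≤ (f i) (sum-map-≤-∑ f₀ uniq) ⟩
  f i + ∑ f₀            ≡⟨ ∑-pullOut f i ⟨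
  ∑ f                   ∎
  where
  open ≤-Reasoning
  f₀ : Fin m → ℕ
  f₀ = updateAt f i (const 0)
  f≡f₀ : ∀ {j} → i ≢ j → f j ≡ f₀ j
  f≡f₀ i≢j = sym (updateAt-minimal _ i f (i≢j ∘ sym))

sum-map-mono-∈ : ∀ {A : Set} {f g : A → ℕ} {x k} → (∀ y → f y ≤ g y) → k + f x ≤ g x →
                 ∀ {L} → x ∈ L → k + sum (map f L) ≤ sum (map g L)
sum-map-mono-∈ {f = f} {g} {x} {k} f≤g k+fx≤gx = go
  where
  sum-mono : ∀ L → sum (map f L) ≤ sum (map g L)
  sum-mono []      = z≤n
  sum-mono (y ∷ L) = +-mono-≤ (f≤g y) (sum-mono L)
  go : ∀ {L} → x ∈ L → k + sum (map f L) ≤ sum (map g L)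
  go {y ∷ L} (here refl)  = subst (_≤ g x + sum (map g L)) (+-assoc k (f x) _) (+-mono-≤ k+fx≤gx (sum-mono L))
  go {y ∷ L} (there x∈L) = subst (_≤ g y + sum (map g L)) (x∙yz≈y∙xz (f y) k _) (+-mono-≤ (f≤g y) (go x∈L))

length-filterᵇ-tabulate : ∀ {A : Set} {m} (p : A → Bool) (f : Fin m → A) →
                          length (filterᵇ p (tabulate f)) ≡ count (p ∘ f)
length-filterᵇ-tabulate {m = zero}  p f = refl
length-filterᵇ-tabulate {m = suc m} p f with p (f zero)
... | true  = cong suc (length-filterᵇ-tabulate p (f ∘ suc))
... | false = length-filterᵇ-tabulate p (f ∘ suc)

length-concatMap-tabulate : ∀ {A B : Set} {m} (g : A → List B) (f : Fin m → A) →
                            length (concatMap g (tabulate f)) ≡ ∑ (length ∘ g ∘ f)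
length-concatMap-tabulate {m = zero}  g f = refl
length-concatMap-tabulate {m = suc m} g f =
  trans (length-++ (g (f zero))) (cong (_+_ (length (g (f zero)))) (length-concatMap-tabulate g (f ∘ suc)))

#pos #neg excess : ∀ {m} → SignedGraph m → Fin m → ℕ
#pos G v = count (λ w → isPosᵇ (G v w))
#neg G v = count (λ w → isNegᵇ (G v w))
excess G v = deg G v ∸ 1

deg≡count : ∀ {m} (G : SignedGraph m) v → deg G v ≡ count (λ w → isEdgeᵇ (G v w))
deg≡count G v = length-filterᵇ-tabulate (λ w → isEdgeᵇ (G v w)) (λ w → w)

deg≡#pos+#neg : ∀ {m} (G : SignedGraph m) v → deg G v ≡ #pos G v + #neg G v
deg≡#pos+#neg G v = trans (deg≡count G v) (trans (sum-cong-≗ (λ w → edge≡pos+neg (G v w)))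
  (∑-distrib-+ (λ w → indicator (isPosᵇ (G v w))) (λ w → indicator (isNegᵇ (G v w)))))
  where
  edge≡pos+neg : ∀ x → indicator (isEdgeᵇ x) ≡ indicator (isPosᵇ x) + indicator (isNegᵇ x)
  edge≡pos+neg nothing    = refl
  edge≡pos+neg (just pos) = refl
  edge≡pos+neg (just neg) = refl

sdeg≡#pos-#neg : ∀ {m} (G : SignedGraph m) v → sdeg G v ≡ + #pos G v - + #neg G v
sdeg≡#pos-#neg G v = cong₂ (λ p n → + p - + n)
  (length-filterᵇ-tabulate (λ w → isPosᵇ (G v w)) (λ w → w))
  (length-filterᵇ-tabulate (λ w → isNegᵇ (G v w)) (λ w → w))

∣sdeg∣≤deg : ∀ {m} (G : SignedGraph m) v → ∣ sdeg G v ∣ ≤ deg G v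
∣sdeg∣≤deg G v rewrite sdeg≡#pos-#neg G v | deg≡#pos+#neg G v =
  ℤ.∣i-j∣≤∣i∣+∣j∣ (+ #pos G v) (+ #neg G v)

deg≡sdeg+2#neg : ∀ {m} (G : SignedGraph m) v {k} → sdeg G v ≡ + k → deg G v ≡ k + 2 * #neg G v
deg≡sdeg+2#neg G v {k} sdeg≡k = begin
  deg G v                       ≡⟨ deg≡#pos+#neg G v ⟩
  #pos G v + #neg G v           ≡⟨ cong (_+ #neg G v) #pos≡k+#neg ⟩
  k + #neg G v + #neg G v       ≡⟨ +-assoc k _ _ ⟩
  k + (#neg G v + #neg G v)     ≡⟨ cong (λ n → k + (#neg G v + n)) (+-identityʳ (#neg G v)) ⟨
  k + 2 * #neg G v              ∎
  where
  open ≡-Reasoning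
  #pos≡k+#neg : #pos G v ≡ k + #neg G v
  #pos≡k+#neg = ℤ.+-injective (begin
    + #pos G v                                ≡⟨ //-rightDividesˡ (+ #neg G v) (+ #pos G v) ⟨
    (+ #pos G v - + #neg G v) ℤ.+ + #neg G v  ≡⟨ cong (ℤ._+ + #neg G v) (sdeg≡#pos-#neg G v) ⟨
    sdeg G v ℤ.+ + #neg G v                   ≡⟨ cong (ℤ._+ + #neg G v) sdeg≡k ⟩
    + (k + #neg G v)                          ∎)

<ᵇ-true : ∀ {m n} → m ℕ.< n → (m ℕ.<ᵇ n) ≡ true
<ᵇ-true {m} {n} = dec-true (m <? n)

<ᵇ-false : ∀ {m n} → ¬ m ℕ.< n → (m ℕ.<ᵇ n) ≡ false
<ᵇ-false {m} {n} = dec-false (m <? n)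

forwardEdge : ∀ {m} → SignedGraph m → Fin m → Fin m → ℕ
forwardEdge G i j = indicator ((toℕ i ℕ.<ᵇ toℕ j) ∧ isEdgeᵇ (G i j))

edgeCount≡∑forwardEdge : ∀ {m} (G : SignedGraph m) → edgeCount G ≡ ∑ (λ i → ∑ (forwardEdge G i))
edgeCount≡∑forwardEdge {m} G = trans (length-concatMap-tabulate row (λ i → i))
  (sum-cong-≗ (λ i → length-filterᵇ-tabulate (λ j → (toℕ i ℕ.<ᵇ toℕ j) ∧ isEdgeᵇ (G i j)) (λ j → j)))
  where
  row : Fin m → List (Fin m)
  row i = filterᵇ (λ j → (toℕ i ℕ.<ᵇ toℕ j) ∧ isEdgeᵇ (G i j)) (allFin m)

edge≡forward+backward : ∀ {m} {G : SignedGraph m} → IsSimple G → ∀ i j →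
                        indicator (isEdgeᵇ (G i j)) ≡ forwardEdge G i j + forwardEdge G j i
edge≡forward+backward {G = G} (symmetric , loopless) i j with <-cmp (toℕ i) (toℕ j)
... | tri< i<j _ _ rewrite <ᵇ-true i<j | <ᵇ-false (<⇒≯ i<j) = sym (+-identityʳ _)
... | tri> _ _ j<i rewrite <ᵇ-true j<i | <ᵇ-false (<⇒≯ j<i) | symmetric i j = refl
... | tri≈ _ i≡j _ with refl ← toℕ-injective i≡j rewrite loopless i | <ᵇ-false (n≮n (toℕ i)) = refl

handshake : ∀ {m} {G : SignedGraph m} → IsSimple G → ∑ (deg G) ≡ edgeCount G + edgeCount G
handshake {m} {G} simple = begin
  ∑ (deg G)                                          ≡⟨ sum-cong-≗ (deg≡count G) ⟩
  ∑ (λ i → ∑ (λ j → indicator (isEdgeᵇ (G i j))))    ≡⟨ sum-cong-≗ (λ i → sum-cong-≗ (edge≡forward+backward simple i)) ⟩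
  ∑ (λ i → ∑ (λ j → F i j + F j i))                  ≡⟨ sum-cong-≗ (λ i → ∑-distrib-+ (F i) (λ j → F j i)) ⟩
  ∑ (λ i → ∑ (F i) + ∑ (λ j → F j i))                ≡⟨ ∑-distrib-+ (λ i → ∑ (F i)) (λ i → ∑ (λ j → F j i)) ⟩
  ∑ (λ i → ∑ (F i)) + ∑ (λ i → ∑ (λ j → F j i))      ≡⟨ cong (_+_ _) (∑-comm F) ⟨
  ∑ (λ i → ∑ (F i)) + ∑ (λ i → ∑ (F i))              ≡⟨ cong₂ _+_ (edgeCount≡∑forwardEdge G) (edgeCount≡∑forwardEdge G) ⟨
  edgeCount G + edgeCount G                          ∎
  where
  open ≡-Reasoning
  F : Fin m → Fin m → ℕ
  F = forwardEdge G

reach⇒deg>0 : ∀ {m} {G : SignedGraph m} {a b} → Reach G a b → a ≢ b → 0 ℕ.< deg G a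
reach⇒deg>0 here a≢a = ⊥-elim (a≢a refl)
reach⇒deg>0 {G = G} {a} (there {w = w} Gaw≡s _) _ rewrite deg≡count G a =
  ≤-trans (≤-reflexive (cong (indicator ∘ isEdgeᵇ) (sym Gaw≡s))) (term≤∑ (λ x → indicator (isEdgeᵇ (G a x))) w)

connected⇒deg>0 : ∀ {m} {G : SignedGraph m} → Connected G → ∀ {u v} → u ≢ v → ∀ w → 0 ℕ.< deg G w
connected⇒deg>0 connected {u} {v} u≢v w with w ≟ u
... | yes refl = reach⇒deg>0 (connected u v) u≢v
... | no w≢u   = reach⇒deg>0 (connected w u) w≢u

∑excess+2≡m : ∀ {m} {G : SignedGraph m} → IsSignedTree G → (∀ w → 0 ℕ.< deg G w) → ∑ (excess G) + 2 ≡ m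
∑excess+2≡m {suc n} {G} (_ , simple , _ , edges) deg>0 = +-cancelʳ-≡ n _ _ (begin
  ∑ (excess G) + 2 + n             ≡⟨ +-assoc (∑ (excess G)) 2 n ⟩
  ∑ (excess G) + suc (suc n)       ≡⟨ +-suc (∑ (excess G)) (suc n) ⟩
  suc (∑ (excess G) + suc n)       ≡⟨ cong suc (trans ∑excess+m≡∑deg (handshake simple)) ⟩
  suc (edgeCount G + edgeCount G)  ≡⟨ cong (λ e → suc (e + e)) edges ⟩
  suc n + n                        ∎)
  where
  open ≡-Reasoning
  ∑excess+m≡∑deg : ∑ (excess G) + suc n ≡ ∑ (deg G)
  ∑excess+m≡∑deg = begin
    ∑ (excess G) + suc n                ≡⟨ cong (_+_ (∑ (excess G))) (∑-one (suc n)) ⟨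
    ∑ (excess G) + ∑ {suc n} (const 1)  ≡⟨ ∑-distrib-+ (excess G) (const 1) ⟨
    ∑ (λ w → excess G w + 1)            ≡⟨ sum-cong-≗ (λ w → m∸n+n≡m (deg>0 w)) ⟩
    ∑ (deg G)                           ∎

preimages : ∀ {A B : Set} (f : A → B) (_≟ᴮ_ : DecidableEquality B) (a : A) {ys : List B} →
            (∀ {y} → y ∈ ys → ∃ λ x → f x ≡ y) →
            ∃ λ xs → map f xs ≡ ys × (f a ∈ ys → a ∈ xs)
preimages f _≟ᴮ_ a {[]}     _   = [] , refl , λ ()
preimages f _≟ᴮ_ a {y ∷ ys} hit with f a ≟ᴮ y | preimages f _≟ᴮ_ a (hit ∘ there)
... | yes fa≡y | xs , fxs≡ys , a∈xs = a ∷ xs , cong₂ _∷_ fa≡y fxs≡ys , λ _ → here refl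
... | no fa≢y  | xs , fxs≡ys , a∈xs with hit (here refl)
...   | x , fx≡y = x ∷ xs , cong₂ _∷_ fx≡y fxs≡ys , a∈
  where
  a∈ : f a ∈ y ∷ ys → a ∈ x ∷ xs
  a∈ (here fa≡y)   = ⊥-elim (fa≢y fa≡y)
  a∈ (there fa∈ys) = there (a∈xs fa∈ys)

adjacent⇒≢ : ∀ {m} {G : SignedGraph m} → IsSimple G → ∀ {u v s} → G u v ≡ just s → u ≢ v
adjacent⇒≢ (_ , loopless) {u} uv≡s refl with () ← trans (sym uv≡s) (loopless u)

OnlyNegativeEdge : ∀ {m} → SignedGraph m → Fin m → Fin m → Set
OnlyNegativeEdge G u v = ∀ a b → G a b ≡ just neg → (a ≡ u × b ≡ v) ⊎ (a ≡ v × b ≡ u)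

module _ {m} {G : SignedGraph m} {u v : Fin m} (only : OnlyNegativeEdge G u v) where

  OnlyNegativeEdge-sym : OnlyNegativeEdge G v u
  OnlyNegativeEdge-sym a b ab-neg = Sum.swap (only a b ab-neg)

  #neg-endpoint : IsSimple G → G u v ≡ just neg → #neg G u ≡ 1
  #neg-endpoint simple uv-neg = trans (∑-single _ v rest≡0) (cong (indicator ∘ isNegᵇ) uv-neg)
    where
    rest≡0 : ∀ j → j ≢ v → indicator (isNegᵇ (G u j)) ≡ 0
    rest≡0 j j≢v with G u j in uj
    ... | nothing  = refl
    ... | just pos = refl
    ... | just neg with only u j uj
    ...   | inj₁ (_ , j≡v) = ⊥-elim (j≢v j≡v)
    ...   | inj₂ (u≡v , _) = ⊥-elim (adjacent⇒≢ simple uv-neg u≡v)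

  #neg-off : ∀ {w} → w ≢ u → w ≢ v → #neg G w ≡ 0
  #neg-off {w} w≢u w≢v = ∑-zero rest≡0
    where
    rest≡0 : ∀ j → indicator (isNegᵇ (G w j)) ≡ 0
    rest≡0 j with G w j in wj
    ... | nothing  = refl
    ... | just pos = refl
    ... | just neg with only w j wj
    ...   | inj₁ (w≡u , _) = ⊥-elim (w≢u w≡u)
    ...   | inj₂ (w≡v , _) = ⊥-elim (w≢v w≡v)

#neg-endpoints : ∀ {m} {G : SignedGraph m} {u v} → OnlyNegativeEdge G u v → IsSimple G → G u v ≡ just neg →
                 #neg G u ≡ 1 × #neg G v ≡ 1
#neg-endpoints only simple uv-neg =
  #neg-endpoint only simple uv-neg , #neg-endpoint (OnlyNegativeEdge-sym only) simple (trans (proj₁ simple _ _) uv-neg)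

deg≡2 : ∀ {m} (G : SignedGraph m) {w} → #neg G w ≡ 1 → sdeg G w ≡ + 0 → deg G w ≡ 2
deg≡2 G {w} #neg≡1 sdeg≡0 = trans (deg≡sdeg+2#neg G w sdeg≡0) (cong (2 *_) #neg≡1)

predAbs : ℤ → ℕ
predAbs x = ∣ x ∣ ∸ 1

∑predAbs : List ℤ → ℕ
∑predAbs xs = sum (map predAbs xs)

excess≡predAbs+2 : ∀ {m} (G : SignedGraph m) {w k} → #neg G w ≡ 1 → sdeg G w ≡ + suc k →
                   excess G w ≡ predAbs (sdeg G w) + 2
excess≡predAbs+2 G {w} {k} #neg≡1 sdeg≡1+k rewrite sdeg≡1+k =
  cong (_∸ 1) (trans (deg≡sdeg+2#neg G w sdeg≡1+k) (cong (λ n → suc k + 2 * n) #neg≡1))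

predAbs-sdeg≤excess : ∀ {m} (G : SignedGraph m) w → predAbs (sdeg G w) ≤ excess G w
predAbs-sdeg≤excess G w = ∸-monoˡ-≤ 1 (∣sdeg∣≤deg G w)

>1⇒≡2+ : ∀ {x} → + 1 < x → ∃ λ k → x ≡ + suc (suc k)
>1⇒≡2+ (+<+ (s≤s (s≤s _))) = _ , refl

sdeg≡0⇒endpoint : ∀ {m} {G : SignedGraph m} → IsSimple G → Connected G → ∀ {u v} → G u v ≡ just neg →
                  OnlyNegativeEdge G u v → ∀ {w} → sdeg G w ≡ + 0 → w ≡ u ⊎ w ≡ v
sdeg≡0⇒endpoint {G = G} simple connected {u} {v} uv-neg only {w} sdeg≡0 with w ≟ u | w ≟ v
... | yes w≡u | _       = inj₁ w≡u
... | no _    | yes w≡v = inj₂ w≡v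
... | no w≢u  | no w≢v  = ⊥-elim (<⇒≢ (connected⇒deg>0 connected (adjacent⇒≢ simple uv-neg) w) (sym deg≡0))
  where
  deg≡0 : deg G w ≡ 0
  deg≡0 = trans (deg≡sdeg+2#neg G w sdeg≡0) (cong (2 *_) (#neg-off only w≢u w≢v))

∈1∷⇒≡1+ : ∀ {xs} → All (+ 1 <_) xs → ∀ {y} → y ∈ + 1 ∷ xs → ∃ λ k → y ≡ + suc k
∈1∷⇒≡1+ _    (here y≡1)    = 0 , y≡1
∈1∷⇒≡1+ xs>1 (there y∈xs) with >1⇒≡2+ (All.lookup xs>1 y∈xs)
... | k , y≡2+k = suc k , y≡2+k

unique-0∷1∷ : ∀ {xs} → All (+ 1 <_) xs → Unique xs → Unique (+ 0 ∷ + 1 ∷ xs)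
unique-0∷1∷ xs>1 xs-unique =
  ((λ ()) ∷ All.map (λ 1<x → ℤ.<⇒≢ (ℤ.<-trans (+<+ ℕ.z<s) 1<x)) xs>1) ∷ All.map ℤ.<⇒≢ xs>1 ∷ xs-unique

sdeg-preimages : ∀ {xs m} {G : SignedGraph m} → Realizes G (+ 1 ∷ + 0 ∷ xs) → ∀ v →
                 ∃ λ L → map (sdeg G) L ≡ + 1 ∷ xs × (sdeg G v ∈ + 1 ∷ xs → v ∈ L)
sdeg-preimages {G = G} (_ , onto) v = preimages (sdeg G) ℤ._≟_ v (onto _ ∘ skip-0)
  where
  skip-0 : ∀ {xs y} → y ∈ + 1 ∷ xs → y ∈ + 1 ∷ + 0 ∷ xs
  skip-0 (here y≡1)    = here y≡1
  skip-0 (there y∈xs) = there (there y∈xs)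

∑predAbs+4<m : ∀ {xs} → All (+ 1 <_) xs → Unique xs →
               ∀ {m} {G : SignedGraph m} → IsSignedTree G → Realizes G (+ 1 ∷ + 0 ∷ xs) →
               ∀ {u v} → G u v ≡ just neg → OnlyNegativeEdge G u v →
               sdeg G u ≡ + 0 → sdeg G v ∈ + 1 ∷ xs → ∑predAbs xs + 4 ℕ.< m
∑predAbs+4<m {xs} xs>1 xs-unique {m} {G} tree@(_ , simple , connected , _) realizes {u} {v} uv-neg only sdeg-u sdeg-v
  with sdeg-preimages realizes v
... | L , sdeg-L , v∈L-if = begin
  suc (∑predAbs xs + 4)                                  ≡⟨ cong suc (trans (+-suc _ 3) (cong suc (+-suc _ 2))) ⟩
  1 + (2 + ∑predAbs xs) + 2                              ≡⟨ cong₂ (λ e s → e + (2 + s) + 2) excess-u ∑predAbs-L ⟨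
  excess G u + (2 + sum (map (predAbs ∘ sdeg G) L)) + 2  ≤⟨ +-monoˡ-≤ 2 (+-monoʳ-≤ (excess G u) bound-L) ⟩
  sum (map (excess G) (u ∷ L)) + 2                       ≤⟨ +-monoˡ-≤ 2 (sum-map-≤-∑ (excess G) uL-unique) ⟩
  ∑ (excess G) + 2                                       ≡⟨ ∑excess+2≡m tree (connected⇒deg>0 connected u≢v) ⟩
  m                                                      ∎
  where
  open ≤-Reasoning
  u≢v : u ≢ v
  u≢v = adjacent⇒≢ simple uv-neg
  uL-unique : Unique (u ∷ L)
  uL-unique = map⁻ (subst Unique (sym (cong₂ _∷_ sdeg-u sdeg-L)) (unique-0∷1∷ xs>1 xs-unique))
  excess-u : excess G u ≡ 1
  excess-u = cong (_∸ 1) (deg≡2 G (proj₁ (#neg-endpoints only simple uv-neg)) sdeg-u)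
  ∑predAbs-L : sum (map (predAbs ∘ sdeg G) L) ≡ ∑predAbs xs
  ∑predAbs-L = cong sum (trans (map-∘ L) (cong (map predAbs) sdeg-L))
  excess-v : excess G v ≡ predAbs (sdeg G v) + 2
  excess-v = excess≡predAbs+2 G (proj₂ (#neg-endpoints only simple uv-neg)) (proj₂ (∈1∷⇒≡1+ xs>1 sdeg-v))
  bound-L : 2 + sum (map (predAbs ∘ sdeg G) L) ≤ sum (map (excess G) L)
  bound-L = sum-map-mono-∈ (predAbs-sdeg≤excess G) (≤-reflexive (trans (+-comm 2 _) (sym excess-v))) (v∈L-if sdeg-v)

edgeTo : ∀ {m} → Fin m → Sign → Fin m → Maybe Sign
edgeTo t s j = if does (j ≟ t) then just s else nothing

edgeTo-self : ∀ {m} (t : Fin m) s → edgeTo t s t ≡ just s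
edgeTo-self t s rewrite dec-true (t ≟ t) refl = refl

edgeTo-other : ∀ {m} {t j : Fin m} s → j ≢ t → edgeTo t s j ≡ nothing
edgeTo-other {t = t} {j} s j≢t rewrite dec-false (j ≟ t) j≢t = refl

count-edgeTo : ∀ {m} (t : Fin m) s (q : Maybe Sign → Bool) → q nothing ≡ false →
               count (λ j → q (edgeTo t s j)) ≡ indicator (q (just s))
count-edgeTo t s q q-nothing = trans (∑-single _ t off-t) (cong (indicator ∘ q) (edgeTo-self t s))
  where
  off-t : ∀ j → j ≢ t → indicator (q (edgeTo t s j)) ≡ 0
  off-t j j≢t rewrite edgeTo-other s j≢t | q-nothing = refl

-- The new vertex is zero, so the old vertices keep their relative order and hence
-- their contribution to edgeCount.
addLeaf : ∀ {m} → SignedGraph m → Fin m → Sign → SignedGraph (suc m)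
addLeaf G t s zero    zero    = nothing
addLeaf G t s zero    (suc j) = edgeTo t s j
addLeaf G t s (suc i) zero    = edgeTo t s i
addLeaf G t s (suc i) (suc j) = G i j

module _ {m} {G : SignedGraph m} {t : Fin m} {s : Sign} where

  addLeaf-simple : IsSimple G → IsSimple (addLeaf G t s)
  addLeaf-simple (symmetric , loopless) = symmetric′ , loopless′
    where
    symmetric′ : ∀ i j → addLeaf G t s i j ≡ addLeaf G t s j i
    symmetric′ zero    zero    = refl
    symmetric′ zero    (suc j) = refl
    symmetric′ (suc i) zero    = refl
    symmetric′ (suc i) (suc j) = symmetric i j
    loopless′ : ∀ i → addLeaf G t s i i ≡ nothing
    loopless′ zero    = refl
    loopless′ (suc i) = loopless i

  reach-suc : ∀ {a b} → Reach G a b → Reach (addLeaf G t s) (suc a) (suc b)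
  reach-suc here           = here
  reach-suc (there ab≡s r) = there ab≡s (reach-suc r)

  reach-++ : ∀ {a b c} → Reach (addLeaf G t s) a b → Reach (addLeaf G t s) b c → Reach (addLeaf G t s) a c
  reach-++ here            r′ = r′
  reach-++ (there ab≡s r) r′ = there ab≡s (reach-++ r r′)

  addLeaf-connected : Connected G → Connected (addLeaf G t s)
  addLeaf-connected connected zero    zero    = here
  addLeaf-connected connected zero    (suc j) = there (edgeTo-self t s) (reach-suc (connected t j))
  addLeaf-connected connected (suc i) zero    = reach-++ (reach-suc (connected i t)) (there (edgeTo-self t s) here)
  addLeaf-connected connected (suc i) (suc j) = reach-suc (connected i j)

  edgeCount-addLeaf : edgeCount (addLeaf G t s) ≡ suc (edgeCount G)
  edgeCount-addLeaf = trans (edgeCount≡∑forwardEdge (addLeaf G t s))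
    (cong₂ _+_ (count-edgeTo t s isEdgeᵇ refl) (sym (edgeCount≡∑forwardEdge G)))

  addLeaf-tree : IsSignedTree G → IsSignedTree (addLeaf G t s)
  addLeaf-tree (s≤s z≤n , simple , connected , edges) =
    s≤s z≤n , addLeaf-simple simple , addLeaf-connected connected , trans edgeCount-addLeaf (cong suc edges)

module _ {m} (G : SignedGraph m) (t : Fin m) where

  sdeg-addLeaf-new : sdeg (addLeaf G t pos) zero ≡ + 1
  sdeg-addLeaf-new = trans (sdeg≡#pos-#neg (addLeaf G t pos) zero)
    (cong₂ (λ p n → + p - + n) (count-edgeTo t pos isPosᵇ refl) (count-edgeTo t pos isNegᵇ refl))

  sdeg-addLeaf-old : ∀ z → sdeg (addLeaf G t pos) (suc z) ≡ sdeg G z ℤ.+ + indicator (isPosᵇ (edgeTo t pos z))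
  sdeg-addLeaf-old z = begin
    sdeg (addLeaf G t pos) (suc z)                         ≡⟨ sdeg≡#pos-#neg (addLeaf G t pos) (suc z) ⟩
    + (a + #pos G z) - + (indicator (isNegᵇ e) + #neg G z)  ≡⟨ cong (λ n → + (a + #pos G z) - + (n + #neg G z)) no-neg ⟩
    + a ℤ.+ + #pos G z - + #neg G z                         ≡⟨ ℤ.+-assoc (+ a) (+ #pos G z) (ℤ.- + #neg G z) ⟩
    + a ℤ.+ (+ #pos G z - + #neg G z)                       ≡⟨ ℤ.+-comm (+ a) (+ #pos G z - + #neg G z) ⟩
    (+ #pos G z - + #neg G z) ℤ.+ + a                       ≡⟨ cong (ℤ._+ + a) (sdeg≡#pos-#neg G z) ⟨
    sdeg G z ℤ.+ + a                                        ∎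
    where
    open ≡-Reasoning
    e : Maybe Sign
    e = edgeTo t pos z
    a : ℕ
    a = indicator (isPosᵇ e)
    no-neg : indicator (isNegᵇ e) ≡ 0
    no-neg with does (z ≟ t)
    ... | true  = refl
    ... | false = refl

  sdeg-addLeaf-attached : sdeg (addLeaf G t pos) (suc t) ≡ sdeg G t ℤ.+ + 1
  sdeg-addLeaf-attached = trans (sdeg-addLeaf-old t) (cong (λ e → sdeg G t ℤ.+ + indicator (isPosᵇ e)) (edgeTo-self t pos))

  sdeg-addLeaf-other : ∀ {z} → z ≢ t → sdeg (addLeaf G t pos) (suc z) ≡ sdeg G z
  sdeg-addLeaf-other {z} z≢t = trans (sdeg-addLeaf-old z)
    (trans (cong (λ e → sdeg G z ℤ.+ + indicator (isPosᵇ e)) (edgeTo-other pos z≢t)) (ℤ.+-identityʳ (sdeg G z)))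

attachLeaves : ∀ {m} k → SignedGraph m → Fin m → SignedGraph (k + m)
attachLeaves zero    G t = G
attachLeaves (suc k) G t = addLeaf (attachLeaves k G t) (k ↑ʳ t) pos

module _ {m} (G : SignedGraph m) (t : Fin m) where

  attachLeaves-tree : ∀ k → IsSignedTree G → IsSignedTree (attachLeaves k G t)
  attachLeaves-tree zero    tree = tree
  attachLeaves-tree (suc k) tree = addLeaf-tree (attachLeaves-tree k tree)

  sdeg-attachLeaves-centre : ∀ k → sdeg (attachLeaves k G t) (k ↑ʳ t) ≡ sdeg G t ℤ.+ + k
  sdeg-attachLeaves-centre zero    = sym (ℤ.+-identityʳ (sdeg G t))
  sdeg-attachLeaves-centre (suc k) = begin
    sdeg (attachLeaves (suc k) G t) (suc k ↑ʳ t)  ≡⟨ sdeg-addLeaf-attached (attachLeaves k G t) (k ↑ʳ t) ⟩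
    sdeg (attachLeaves k G t) (k ↑ʳ t) ℤ.+ + 1   ≡⟨ cong (ℤ._+ + 1) (sdeg-attachLeaves-centre k) ⟩
    sdeg G t ℤ.+ + k ℤ.+ + 1                     ≡⟨ ℤ.+-assoc (sdeg G t) (+ k) (+ 1) ⟩
    sdeg G t ℤ.+ + (k + 1)                       ≡⟨ cong (λ n → sdeg G t ℤ.+ + n) (+-comm k 1) ⟩
    sdeg G t ℤ.+ + suc k                         ∎
    where open ≡-Reasoning

  sdeg-attachLeaves-other : ∀ k {z} → z ≢ t → sdeg (attachLeaves k G t) (k ↑ʳ z) ≡ sdeg G z
  sdeg-attachLeaves-other zero    z≢t = refl
  sdeg-attachLeaves-other (suc k) z≢t =
    trans (sdeg-addLeaf-other (attachLeaves k G t) (k ↑ʳ t) (z≢t ∘ ↑ʳ-injective k _ _))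
          (sdeg-attachLeaves-other k z≢t)

  attachLeaves-old-or-leaf : ∀ k w → (∃ λ z → w ≡ k ↑ʳ z) ⊎ sdeg (attachLeaves k G t) w ≡ + 1
  attachLeaves-old-or-leaf zero    w       = inj₁ (w , refl)
  attachLeaves-old-or-leaf (suc k) zero    = inj₂ (sdeg-addLeaf-new (attachLeaves k G t) (k ↑ʳ t))
  attachLeaves-old-or-leaf (suc k) (suc w) with attachLeaves-old-or-leaf k w
  ... | inj₁ (z , refl) = inj₁ (z , refl)
  ... | inj₂ sdeg≡1     = centre-or-leaf (w ≟ k ↑ʳ t)
    where
    centre-or-leaf : Dec (w ≡ k ↑ʳ t) →
                     (∃ λ z → suc w ≡ suc k ↑ʳ z) ⊎ sdeg (attachLeaves (suc k) G t) (suc w) ≡ + 1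
    centre-or-leaf (yes refl) = inj₁ (t , refl)
    centre-or-leaf (no w≢)    = inj₂ (trans (sdeg-addLeaf-other (attachLeaves k G t) (k ↑ʳ t) w≢) sdeg≡1)

record AnchoredRealization (D : List ℤ) (m : ℕ) : Set where
  field
    graph          : SignedGraph m
    isTree         : IsSignedTree graph
    realizes       : Realizes graph D
    anchor         : Fin m
    sdeg-anchor≡1  : sdeg graph anchor ≡ + 1

-- The path + − + , with signed degrees 1, 0, 0, 1.
path₄ : SignedGraph 4
path₄ = addLeaf (addLeaf (addLeaf (λ _ _ → nothing) zero pos) zero neg) zero pos

path₄-realization : AnchoredRealization (+ 1 ∷ + 0 ∷ []) 4
path₄-realization = record
  { graph         = path₄
  ; isTree        = addLeaf-tree (addLeaf-tree (addLeaf-tree vertex-tree))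
  ; realizes      = sdeg∈ , onto
  ; anchor        = zero
  ; sdeg-anchor≡1 = refl
  }
  where
  vertex-tree : IsSignedTree {1} (λ _ _ → nothing)
  vertex-tree = s≤s z≤n , ((λ _ _ → refl) , (λ _ → refl)) , (λ { zero zero → here }) , refl
  sdeg∈ : ∀ w → sdeg path₄ w ∈ + 1 ∷ + 0 ∷ []
  sdeg∈ zero                   = here refl
  sdeg∈ (suc zero)             = there (here refl)
  sdeg∈ (suc (suc zero))       = there (here refl)
  sdeg∈ (suc (suc (suc zero))) = here refl
  onto : ∀ d → d ∈ + 1 ∷ + 0 ∷ [] → ∃ λ w → sdeg path₄ w ≡ d
  onto d (here d≡1)         = zero , sym d≡1
  onto d (there (here d≡0)) = suc zero , sym d≡0

-- The new leaves keep the value 1 realized while the anchor moves up to k + 2.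
extend : ∀ {xs m} → AnchoredRealization (+ 1 ∷ + 0 ∷ xs) m → ∀ k →
         AnchoredRealization (+ 1 ∷ + 0 ∷ + suc (suc k) ∷ xs) (suc k + m)
extend {xs} {m} R k = record
  { graph         = G′
  ; isTree        = attachLeaves-tree graph anchor (suc k) isTree
  ; realizes      = sdeg∈ , onto
  ; anchor        = zero
  ; sdeg-anchor≡1 = sdeg-new≡1
  }
  where
  open AnchoredRealization R
  G′ : SignedGraph (suc k + m)
  G′ = attachLeaves (suc k) graph anchor
  sdeg-new≡1 : sdeg G′ zero ≡ + 1
  sdeg-new≡1 = sdeg-addLeaf-new (attachLeaves k graph anchor) (k ↑ʳ anchor)
  D⊆D′ : ∀ {d} → d ∈ + 1 ∷ + 0 ∷ xs → d ∈ + 1 ∷ + 0 ∷ + suc (suc k) ∷ xs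
  D⊆D′ (here d≡1)              = here d≡1
  D⊆D′ (there (here d≡0))      = there (here d≡0)
  D⊆D′ (there (there d∈xs))    = there (there (there d∈xs))
  sdeg∈ : ∀ w → sdeg G′ w ∈ + 1 ∷ + 0 ∷ + suc (suc k) ∷ xs
  sdeg∈ w with attachLeaves-old-or-leaf graph anchor (suc k) w
  ... | inj₂ sdeg≡1 = here sdeg≡1
  ... | inj₁ (z , refl) with z ≟ anchor
  ...   | yes refl = there (there (here (trans (sdeg-attachLeaves-centre graph anchor (suc k))
                                              (cong (ℤ._+ + suc k) sdeg-anchor≡1))))
  ...   | no z≢    = D⊆D′ (subst (_∈ _) (sym (sdeg-attachLeaves-other graph anchor (suc k) z≢)) (proj₁ realizes z))
  onto-old : ∀ {d} → d ∈ + 1 ∷ + 0 ∷ xs → ∃ λ w → sdeg G′ w ≡ d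
  onto-old {d} d∈D with proj₂ realizes d d∈D
  ... | z , sdeg≡d with z ≟ anchor
  ...   | yes refl = zero , trans sdeg-new≡1 (trans (sym sdeg-anchor≡1) sdeg≡d)
  ...   | no z≢    = suc k ↑ʳ z , trans (sdeg-attachLeaves-other graph anchor (suc k) z≢) sdeg≡d
  onto : ∀ d → d ∈ + 1 ∷ + 0 ∷ + suc (suc k) ∷ xs → ∃ λ w → sdeg G′ w ≡ d
  onto d (here d≡1)                   = onto-old (here d≡1)
  onto d (there (here d≡0))           = onto-old (there (here d≡0))
  onto d (there (there (here d≡x)))   = suc k ↑ʳ anchor , trans (sdeg-attachLeaves-centre graph anchor (suc k))
                                                            (trans (cong (ℤ._+ + suc k) sdeg-anchor≡1) (sym d≡x))
  onto d (there (there (there d∈xs))) = onto-old (there (there d∈xs))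

anchoredRealization : ∀ {xs} → All (+ 1 <_) xs → AnchoredRealization (+ 1 ∷ + 0 ∷ xs) (∑predAbs xs + 4)
anchoredRealization []            = path₄-realization
anchoredRealization (x>1 ∷ xs>1) with >1⇒≡2+ x>1
... | k , refl = subst (AnchoredRealization _) (sym (+-assoc (suc k) _ 4)) (extend (anchoredRealization xs>1) k)

optimal⇒m≤∑predAbs+4 : ∀ {xs} → All (+ 1 <_) xs → ∀ {m} {G : SignedGraph m} →
                OptimalRealization G (+ 1 ∷ + 0 ∷ xs) → m ≤ ∑predAbs xs + 4
optimal⇒m≤∑predAbs+4 xs>1 (_ , _ , minimal) = minimal _ graph isTree realizes
  where open AnchoredRealization (anchoredRealization xs>1)

negative-endpoints-deg≡2 : ∀ {xs} → All (+ 1 <_) xs → Unique xs →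
                           ∀ {m} {G : SignedGraph m} → OptimalRealization G (+ 1 ∷ + 0 ∷ xs) →
                           ∀ {u v} → G u v ≡ just neg → OnlyNegativeEdge G u v →
                           sdeg G u ≡ + 0 → deg G u ≡ 2 × deg G v ≡ 2
negative-endpoints-deg≡2 {xs} xs>1 xs-unique {G = G} optimal@(tree , realizes , _) {u} {v} uv-neg only sdeg-u≡0 =
  deg≡2 G #neg-u≡1 sdeg-u≡0 , deg-v (proj₁ realizes v)
  where
  #neg-u≡1 : #neg G u ≡ 1
  #neg-u≡1 = proj₁ (#neg-endpoints only (proj₁ (proj₂ tree)) uv-neg)
  #neg-v≡1 : #neg G v ≡ 1
  #neg-v≡1 = proj₂ (#neg-endpoints only (proj₁ (proj₂ tree)) uv-neg)
  too-long : sdeg G v ∈ + 1 ∷ xs → deg G v ≡ 2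
  too-long sdeg-v = ⊥-elim (<⇒≱ (∑predAbs+4<m xs>1 xs-unique tree realizes uv-neg only sdeg-u≡0 sdeg-v)
                                (optimal⇒m≤∑predAbs+4 xs>1 optimal))
  deg-v : sdeg G v ∈ + 1 ∷ + 0 ∷ xs → deg G v ≡ 2
  deg-v (here sdeg≡1)            = too-long (here sdeg≡1)
  deg-v (there (here sdeg≡0))    = deg≡2 G #neg-v≡1 sdeg≡0
  deg-v (there (there sdeg∈xs)) = too-long (there sdeg∈xs)

mainTheorem10 : (xs : List ℤ) → 1 ≤ length xs → Unique xs → All (λ x → + 1 < x) xs →
                (m : ℕ) (G : SignedGraph m) →
                OptimalRealization G (+ 1 ∷ + 0 ∷ xs) →
                (u v : Fin m) → G u v ≡ just neg →
                (∀ a b → G a b ≡ just neg → (a ≡ u × b ≡ v) ⊎ (a ≡ v × b ≡ u)) →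
                deg G u ≡ 2 × deg G v ≡ 2
mainTheorem10 xs _ xs-unique xs>1 m G optimal@((_ , simple , connected , _) , realizes , _) u v uv-neg only
  with proj₂ realizes (+ 0) (there (here refl))
... | z , sdeg-z≡0 with sdeg≡0⇒endpoint simple connected uv-neg only sdeg-z≡0
...   | inj₁ refl = negative-endpoints-deg≡2 xs>1 xs-unique optimal uv-neg only sdeg-z≡0
...   | inj₂ refl = swap (negative-endpoints-deg≡2 xs>1 xs-unique optimal (trans (proj₁ simple v u) uv-neg)
                                                   (OnlyNegativeEdge-sym only) sdeg-z≡0)
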